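{- Let $G$ and $H$ be finite, simple, connected graphs, each with at least two vertices. Then $$\min\{g(G),g(H)\}\le g(G\boxtimes H)\le g(G)\,g(H).$$ Furthermore, both bounds are sharp, i.e. each of the two inequalities holds with equality for some such pair of graphs $G,H$.
   Context: For a connected graph $G$, $d_G(u,v)$ is the distance between $u$ and $v$. The closed interval $I[x,y]$ consists of $x$, $y$ and all vertices lying on some shortest $x$–$y$ path. For $S\subseteq V(G)$, $I[S]=\bigcup_{u,v\in S}I[u,v]$. A set $S$ is geodetic if $I[S]=V(G)$; the geodetic number $g(G)$ is the minimum cardinality of a geodetic set of $G$. The strong product $G\boxtimes H$ has vertex set $V(G)\times V(H)$, with $(g,h)$ and $(g',h')$ adjacent whenever ($g=g'$ and $hh'\in E(H)$), or ($h=h'$ and $gg'\in E(G)$), or ($gg'\in E(G)$ and $hh'\in E(H)$). -}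

module Defs where

open import Level using (0ℓ)
open import Data.Nat using (ℕ; zero; suc; _+_; _*_; _≤_)
open import Data.Fin using (Fin; remQuot)
open import Data.Fin.Subset using (Subset; _∈_; ∣_∣)
open import Data.Product using (Σ; ∃; _×_; _,_; proj₁; proj₂)
open import Data.Sum using (_⊎_; inj₁; inj₂)
open import Relation.Nullary using (¬_)
open import Relation.Binary.PropositionalEquality using (_≡_; refl; sym)

record Graph (n : ℕ) : Set₁ where
  field
    Adj     : Fin n → Fin n → Set
    Adj-sym : ∀ {u v} → Adj u v → Adj v u
    Adj-irr : ∀ {u} → ¬ Adj u u
open Graph public

data Walk {n : ℕ} (G : Graph n) : Fin n → Fin n → ℕ → Set where
  nil  : ∀ {u} → Walk G u u zero
  cons : ∀ {u w v k} → Adj G u w → Walk G w v k → Walk G u v (suc k)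

data OnWalk {n : ℕ} {G : Graph n} (x : Fin n) :
       ∀ {u v k} → Walk G u v k → Set where
  here-nil  : OnWalk x (nil {u = x})
  here-cons : ∀ {w v k} (e : Adj G x w) (p : Walk G w v k) → OnWalk x (cons e p)
  there     : ∀ {u w v k} (e : Adj G u w) {p : Walk G w v k} →
              OnWalk x p → OnWalk x (cons e p)

Connected : ∀ {n} → Graph n → Set
Connected G = ∀ u v → ∃ λ k → Walk G u v k

IsDist : ∀ {n} → Graph n → Fin n → Fin n → ℕ → Set
IsDist G u v k = Walk G u v k × (∀ m → Walk G u v m → k ≤ m)

InInterval : ∀ {n} → Graph n → Fin n → Fin n → Fin n → Set
InInterval G x y w =
  Σ ℕ λ k → Σ (Walk G x y k) λ p → IsDist G x y k × OnWalk w p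

Geodetic : ∀ {n} → Graph n → Subset n → Set
Geodetic {n} G S =
  ∀ (w : Fin n) → Σ (Fin n) λ x → Σ (Fin n) λ y →
    x ∈ S × y ∈ S × InInterval G x y w

IsGeodeticNumber : ∀ {n} → Graph n → ℕ → Set
IsGeodeticNumber {n} G k =
  (Σ (Subset n) λ S → Geodetic G S × ∣ S ∣ ≡ k) ×
  (∀ (S : Subset n) → Geodetic G S → k ≤ ∣ S ∣)

-- Strong product; vertex (g,h) encoded via remQuot as an element of Fin (n * m).
StrongAdj : ∀ {n m} → Graph n → Graph m → Fin (n * m) → Fin (n * m) → Set
StrongAdj {n} {m} G H p q =
  let a = proj₁ (remQuot {n} m p) ; b = proj₂ (remQuot {n} m p)
      a' = proj₁ (remQuot {n} m q) ; b' = proj₂ (remQuot {n} m q)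
  in (a ≡ a' × Adj H b b') ⊎ (b ≡ b' × Adj G a a') ⊎ (Adj G a a' × Adj H b b')

_⊠_ : ∀ {n m} → Graph n → Graph m → Graph (n * m)
_⊠_ {n} {m} G H = record
  { Adj = StrongAdj G H
  ; Adj-sym = λ { (inj₁ (e , h)) → inj₁ (sym e , Adj-sym H h)
                ; (inj₂ (inj₁ (e , g))) → inj₂ (inj₁ (sym e , Adj-sym G g))
                ; (inj₂ (inj₂ (g , h))) → inj₂ (inj₂ (Adj-sym G g , Adj-sym H h)) }
  ; Adj-irr = λ { (inj₁ (_ , h)) → Adj-irr H h
                ; (inj₂ (inj₁ (_ , g))) → Adj-irr G g
                ; (inj₂ (inj₂ (g , _))) → Adj-irr G g } }

module Submission where

-- Distances in G ⊠ H are maxima of coordinate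
-- distances: coordinate walks of lengths i, j pair to a product walk of length
-- i ⊔ j (pairʷ), and the projections are weak homomorphisms, which shorten walks.
-- Upper bound: if g splits a G-geodesic into legs i, i' and h an H-geodesic into
-- legs j, j', say with i ⊓ i' ≤ j ⊓ j', then going from the nearer end s to g and
-- back while following the H-geodesic puts (g,h) on a geodesic between two
-- vertices of S × T, so S × T is geodetic (×ˢ-geodetic).  Lower bound: a shortest
-- walk through (g,h) projects onto a geodesic through g or one through h, as two
-- shortcuts would pair to a shortcut; a double-negation shift over the finite
-- vertex sets makes one coordinate shadow of a geodetic set geodetic
-- (shadow-geodetic), and the goal, a decidable inequality, is stable.
-- Sharpness: K₂ ⊠ K₂ = K₄; and G₈ ⊠ K₄, where g(G₈) = 4 by exhaustive search and
-- some 4-set T of G₈ has every vertex as an inner vertex of a T-geodesic, which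
-- makes T × {h₀} geodetic (innerCover-⊠-geodetic).

open import Defs
open import Data.Bool using (Bool; true; false; T)
open import Data.Bool.Properties using (T?)
open import Data.Empty using (⊥-elim)
open import Data.Fin using (Fin; zero; suc; combine; remQuot; _≟_)
open import Data.Fin.Properties using (remQuot-combine; combine-remQuot; all?; any?)
open import Data.Fin.Subset using (Subset; _∈_; ∣_∣; ⊥; ⊤; ⁅_⁆; _∪_; _⊆_; inside; outside)
open import Data.Fin.Subset.Properties
  using (x∈p∪q⁺; x∈⁅x⁆; ∣⊥∣≡0; ∣⁅x⁆∣≡1; ∈⊤; ∣⊤∣≡n; p⊆q⇒∣p∣≤∣q∣; _∈?_; anySubset?)
open import Data.Nat using (ℕ; zero; suc; _+_; _*_; _⊔_; _⊓_; _≤_; _<_; z≤n; s≤s; _≤?_; _<?_) renaming (_≟_ to _≟ℕ_)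
open import Data.Nat.Properties
  using (≤-refl; ≤-reflexive; ≤-trans; ≤-antisym; n≤1+n; m≤n⇒m≤1+n; ≰⇒>; ≰⇒≥; ≮⇒≥; <⇒≱;
         +-comm; +-suc; +-mono-≤; +-monoʳ-≤; *-identityʳ; m≥n⇒m⊔n≡m; m≤n⇒m⊔n≡n; ⊔-pres-<m;
         m≤n⇒m⊓n≡m; m≥n⇒m⊓n≡n; m⊓n≤m; m⊓n≤n; module ≤-Reasoning)
open import Data.Product using (Σ; ∃; ∃₂; _×_; _,_; proj₁; proj₂)
open import Data.Sum using (_⊎_; inj₁; inj₂; [_,_])
open import Data.Vec using (Vec; []; _∷_; lookup; here; there)
open import Function using (_∘_)
open import Relation.Nullary using (¬_; Dec; yes; no)
open import Relation.Nullary.Decidable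
  using (_×-dec_; _⊎-dec_; _→-dec_; ¬?; toWitness; toWitnessFalse; decidable-stable)
open import Relation.Nullary.Negation using (¬¬-map)
open import Relation.Binary.PropositionalEquality
  using (_≡_; refl; sym; cong; cong₂; subst; subst₂; module ≡-Reasoning)

private
  variable
    n m k l : ℕ

module _ {G : Graph n} where

  infixr 5 _++ʷ_

  _++ʷ_ : ∀ {u v w i j} → Walk G u v i → Walk G v w j → Walk G u w (i + j)
  nil      ++ʷ q = q
  cons e p ++ʷ q = cons e (p ++ʷ q)

  reverseʷ : ∀ {u v i} → Walk G u v i → Walk G v u i
  reverseʷ nil                = nil
  reverseʷ {i = suc i} (cons e p) =
    subst (Walk G _ _) (+-comm i 1) (reverseʷ p ++ʷ cons (Adj-sym G e) nil)

  start-on : ∀ {u v i} (p : Walk G u v i) → OnWalk u p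
  start-on nil        = here-nil
  start-on (cons e p) = here-cons e p

  junction-on : ∀ {u v w i j} (p : Walk G u v i) (q : Walk G v w j) → OnWalk v (p ++ʷ q)
  junction-on nil        q = start-on q
  junction-on (cons e p) q = there e (junction-on p q)

  split-at : ∀ {x u v k} {p : Walk G u v k} → OnWalk x p →
             ∃₂ λ i j → Walk G u x i × Walk G x v j × i + j ≡ k
  split-at here-nil                = 0 , 0 , nil , nil , refl
  split-at (here-cons {k = k} e p) = 0 , suc k , nil , cons e p , refl
  split-at (there e on) with split-at on
  ... | i , j , l , r , i+j≡k = suc i , j , cons e l , r , cong suc i+j≡k

  castʷ : ∀ {u u' v v' k} → u ≡ u' → v ≡ v' → Walk G u v k → Walk G u' v' k
  castʷ refl refl p = p

  on-castʷ : ∀ {x u u' v v' k} (e : u ≡ u') (e' : v ≡ v') (p : Walk G u v k) →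
             OnWalk x p → OnWalk x (castʷ e e' p)
  on-castʷ refl refl p on = on

record OnGeodesic (G : Graph n) (x y w : Fin n) (i j : ℕ) : Set where
  constructor geodesic
  field
    left     : Walk G x w i
    right    : Walk G w y j
    shortest : ∀ k → Walk G x y k → i + j ≤ k

module _ {G : Graph n} {x y w : Fin n} where

  onGeodesic⇒interval : ∀ {i j} → OnGeodesic G x y w i j → InInterval G x y w
  onGeodesic⇒interval {i} {j} (geodesic l r sh) =
    i + j , l ++ʷ r , (l ++ʷ r , sh) , junction-on l r

  interval⇒onGeodesic : InInterval G x y w → ∃₂ λ i j → OnGeodesic G x y w i j
  interval⇒onGeodesic (_ , _ , (_ , sh) , on) with split-at on
  ... | i , j , l , r , refl = i , j , geodesic l r sh

nearer-end : ∀ {G : Graph n} {S : Subset n} {x y g i j} → x ∈ S → y ∈ S →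
             OnGeodesic G x y g i j → ∃ λ s → s ∈ S × Walk G s g (i ⊓ j)
nearer-end {i = i} {j} x∈ y∈ (geodesic l r _) with i ≤? j
... | yes i≤j = _ , x∈ , subst (Walk _ _ _) (sym (m≤n⇒m⊓n≡m i≤j)) l
... | no  i≰j = _ , y∈ , subst (Walk _ _ _) (sym (m≥n⇒m⊓n≡n (≰⇒≥ i≰j))) (reverseʷ r)

InHull : Graph n → Subset n → Fin n → Set
InHull {n} G S w = Σ (Fin n) λ x → Σ (Fin n) λ y → x ∈ S × y ∈ S × InInterval G x y w

isGeodeticNumber : {G : Graph n} (S : Subset n) → Geodetic G S → ∣ S ∣ ≤ k →
                   (∀ S' → Geodetic G S' → k ≤ ∣ S' ∣) → IsGeodeticNumber G k
isGeodeticNumber S geo ∣S∣≤k minimal = (S , geo , ≤-antisym ∣S∣≤k (minimal S geo)) , minimal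

WeakHom : Graph n → Graph m → (Fin n → Fin m) → Set
WeakHom G H f = ∀ {u v} → Adj G u v → f u ≡ f v ⊎ Adj H (f u) (f v)

record WalkImage {G : Graph n} (H : Graph m) (f : Fin n → Fin m)
                 {u v k} (p : Walk G u v k) : Set where
  field
    {len} : ℕ
    len≤  : len ≤ k
    walk  : Walk H (f u) (f v) len
    on    : ∀ {x} → OnWalk x p → OnWalk (f x) walk

module _ {G : Graph n} {H : Graph m} {f : Fin n → Fin m} (φ : WeakHom G H f) where

  mapʷ : ∀ {u v k} (p : Walk G u v k) → WalkImage H f p
  mapʷ nil = record { len≤ = z≤n ; walk = nil ; on = λ { here-nil → here-nil } }
  mapʷ (cons e p) with φ e | mapʷ p
  ... | inj₁ fu≡fw | record { len≤ = len≤ ; walk = w ; on = on } = record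
    { len≤ = m≤n⇒m≤1+n len≤
    ; walk = castʷ (sym fu≡fw) refl w
    ; on   = λ { (here-cons _ _) → start-on (castʷ (sym fu≡fw) refl w)
               ; (there _ o)     → on-castʷ (sym fu≡fw) refl w (on o) } }
  ... | inj₂ a | record { len≤ = len≤ ; walk = w ; on = on } = record
    { len≤ = s≤s len≤
    ; walk = cons a w
    ; on   = λ { (here-cons _ _) → here-cons a w
               ; (there _ o)     → there a (on o) } }

  image-interval : ∀ {x y w k} (p : Walk G x y k) → OnWalk w p →
                   (∀ L → Walk H (f x) (f y) L → k ≤ L) → InInterval H (f x) (f y) (f w)
  image-interval p on-p lower = len , walk , (walk , λ L q → ≤-trans len≤ (lower L q)) , on on-p
    where
      walkImage : WalkImage H f p
      walkImage = mapʷ p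
      open WalkImage walkImage

LowerOrShorter : (ℕ → Set) → ℕ → Set
LowerOrShorter X k = (∀ L → X L → k ≤ L) ⊎ ∃ λ L → X L × L < k

lower-or-shorter : (X : ℕ → Set) (k : ℕ) → ¬ ¬ LowerOrShorter X k
lower-or-shorter X k neither = neither (inj₁ λ L x →
  decidable-stable (k ≤? L) λ k≰L → neither (inj₂ (L , x , ≰⇒> k≰L)))

¬¬-zip : ∀ {A B : Set} → ¬ ¬ A → ¬ ¬ B → ¬ ¬ (A × B)
¬¬-zip ¬¬a ¬¬b ¬ab = ¬¬a λ a → ¬¬b λ b → ¬ab (a , b)

¬¬-∀-Fin : ∀ k {X : Fin k → Set} → (∀ i → ¬ ¬ X i) → ¬ ¬ (∀ i → X i)
¬¬-∀-Fin zero    h ¬all = ¬all λ ()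
¬¬-∀-Fin (suc k) h ¬all = h zero λ x₀ → ¬¬-∀-Fin k (h ∘ suc) λ xs →
  ¬all λ { zero → x₀ ; (suc i) → xs i }

¬¬-rectangle : {X : Fin k → Set} {Y : Fin l → Set} → (∀ i j → ¬ ¬ (X i ⊎ Y j)) →
               ¬ ¬ ((∀ i → X i) ⊎ (∀ j → Y j))
¬¬-rectangle {k} {l} h ¬either =
  ¬¬-∀-Fin k (λ i ¬Xi → ¬¬-∀-Fin l (λ j ¬Yj → h i j [ ¬Xi , ¬Yj ]) (¬either ∘ inj₂))
             (¬either ∘ inj₁)

⋃[_]_ : Subset k → (Fin k → Subset l) → Subset l
⋃[ []          ] F = ⊥
⋃[ inside  ∷ S ] F = F zero ∪ ⋃[ S ] (F ∘ suc)
⋃[ outside ∷ S ] F = ⋃[ S ] (F ∘ suc)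

∈-⋃ : ∀ {S : Subset k} {F : Fin k → Subset l} {i x} → i ∈ S → x ∈ F i → x ∈ ⋃[ S ] F
∈-⋃ {S = inside  ∷ S}       here       x∈ = x∈p∪q⁺ (inj₁ x∈)
∈-⋃ {S = inside  ∷ S} {F} (there i∈) x∈ = x∈p∪q⁺ {p = F zero} (inj₂ (∈-⋃ i∈ x∈))
∈-⋃ {S = outside ∷ S}     (there i∈) x∈ = ∈-⋃ i∈ x∈

∣p∪q∣≤∣p∣+∣q∣ : (p q : Subset k) → ∣ p ∪ q ∣ ≤ ∣ p ∣ + ∣ q ∣
∣p∪q∣≤∣p∣+∣q∣ []            []            = z≤n
∣p∪q∣≤∣p∣+∣q∣ (inside  ∷ p) (outside ∷ q) = s≤s (∣p∪q∣≤∣p∣+∣q∣ p q)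
∣p∪q∣≤∣p∣+∣q∣ (inside  ∷ p) (inside  ∷ q) =
  s≤s (≤-trans (∣p∪q∣≤∣p∣+∣q∣ p q) (+-monoʳ-≤ ∣ p ∣ (n≤1+n ∣ q ∣)))
∣p∪q∣≤∣p∣+∣q∣ (outside ∷ p) (inside  ∷ q) =
  subst (suc ∣ p ∪ q ∣ ≤_) (sym (+-suc ∣ p ∣ ∣ q ∣)) (s≤s (∣p∪q∣≤∣p∣+∣q∣ p q))
∣p∪q∣≤∣p∣+∣q∣ (outside ∷ p) (outside ∷ q) = ∣p∪q∣≤∣p∣+∣q∣ p q

∣⋃∣≤ : ∀ (S : Subset k) {F : Fin k → Subset l} {c} → (∀ i → ∣ F i ∣ ≤ c) →
       ∣ ⋃[ S ] F ∣ ≤ ∣ S ∣ * c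
∣⋃∣≤ {l = l} []            bound = ≤-reflexive (∣⊥∣≡0 l)
∣⋃∣≤ (inside  ∷ S) {F}     bound =
  ≤-trans (∣p∪q∣≤∣p∣+∣q∣ (F zero) (⋃[ S ] (F ∘ suc)))
          (+-mono-≤ (bound zero) (∣⋃∣≤ S (bound ∘ suc)))
∣⋃∣≤ (outside ∷ S) bound = ∣⋃∣≤ S (bound ∘ suc)

image : Subset k → (Fin k → Fin l) → Subset l
image S f = ⋃[ S ] λ i → ⁅ f i ⁆

∈-image : ∀ {S : Subset k} {f : Fin k → Fin l} {i} → i ∈ S → f i ∈ image S f
∈-image {f = f} {i} i∈ = ∈-⋃ i∈ (x∈⁅x⁆ (f i))

∣image∣≤ : ∀ (S : Subset k) (f : Fin k → Fin l) → ∣ image S f ∣ ≤ ∣ S ∣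
∣image∣≤ S f = subst (∣ image S f ∣ ≤_) (*-identityʳ ∣ S ∣)
                     (∣⋃∣≤ S λ i → ≤-reflexive (∣⁅x⁆∣≡1 (f i)))

_×ˢ_ : Subset n → Subset m → Subset (n * m)
S ×ˢ T = ⋃[ S ] λ s → image T (combine s)

∈-×ˢ : ∀ {S : Subset n} {T : Subset m} {s t} → s ∈ S → t ∈ T → combine s t ∈ S ×ˢ T
∈-×ˢ s∈ t∈ = ∈-⋃ s∈ (∈-image t∈)

∣×ˢ∣≤ : ∀ (S : Subset n) (T : Subset m) → ∣ S ×ˢ T ∣ ≤ ∣ S ∣ * ∣ T ∣
∣×ˢ∣≤ S T = ∣⋃∣≤ S λ s → ∣image∣≤ T (combine s)

module Strong {n m : ℕ} (G : Graph n) (H : Graph m) where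

  P : Graph (n * m)
  P = G ⊠ H

  ⟨_,_⟩ : Fin n → Fin m → Fin (n * m)
  ⟨_,_⟩ = combine

  π₁ : Fin (n * m) → Fin n
  π₁ p = proj₁ (remQuot {n} m p)

  π₂ : Fin (n * m) → Fin m
  π₂ p = proj₂ (remQuot {n} m p)

  π₁-⟨⟩ : ∀ a b → π₁ ⟨ a , b ⟩ ≡ a
  π₁-⟨⟩ a b = cong proj₁ (remQuot-combine {n} {m} a b)

  π₂-⟨⟩ : ∀ a b → π₂ ⟨ a , b ⟩ ≡ b
  π₂-⟨⟩ a b = cong proj₂ (remQuot-combine {n} {m} a b)

  ⟨π₁,π₂⟩ : ∀ p → ⟨ π₁ p , π₂ p ⟩ ≡ p
  ⟨π₁,π₂⟩ p = combine-remQuot {n} m p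

  StrongAdjᶜ : Fin n × Fin m → Fin n × Fin m → Set
  StrongAdjᶜ (a , b) (a' , b') =
    (a ≡ a' × Adj H b b') ⊎ (b ≡ b' × Adj G a a') ⊎ (Adj G a a' × Adj H b b')

  ⟨⟩-adj : ∀ {a a' b b'} → StrongAdjᶜ (a , b) (a' , b') → Adj P ⟨ a , b ⟩ ⟨ a' , b' ⟩
  ⟨⟩-adj {a} {a'} {b} {b'} =
    subst₂ StrongAdjᶜ (sym (remQuot-combine {n} {m} a b)) (sym (remQuot-combine {n} {m} a' b'))

  π₁-weak : WeakHom P G π₁
  π₁-weak (inj₁ (same , _))        = inj₁ same
  π₁-weak (inj₂ (inj₁ (_ , a)))    = inj₂ a
  π₁-weak (inj₂ (inj₂ (a , _)))    = inj₂ a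

  π₂-weak : WeakHom P H π₂
  π₂-weak (inj₁ (_ , b))           = inj₂ b
  π₂-weak (inj₂ (inj₁ (same , _))) = inj₁ same
  π₂-weak (inj₂ (inj₂ (_ , b)))    = inj₂ b

  -- Walks in the two coordinates combine into a walk of length i ⊔ j: move
  -- diagonally while both coordinates move, then along the remaining one.
  along₁ : ∀ {a a' b i} → Walk G a a' i → Walk P ⟨ a , b ⟩ ⟨ a' , b ⟩ i
  along₁ nil        = nil
  along₁ (cons e p) = cons (⟨⟩-adj (inj₂ (inj₁ (refl , e)))) (along₁ p)

  along₂ : ∀ {a b b' j} → Walk H b b' j → Walk P ⟨ a , b ⟩ ⟨ a , b' ⟩ j
  along₂ nil        = nil
  along₂ (cons e q) = cons (⟨⟩-adj (inj₁ (refl , e))) (along₂ q)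

  pairʷ : ∀ {a a' b b' i j} → Walk G a a' i → Walk H b b' j →
          Walk P ⟨ a , b ⟩ ⟨ a' , b' ⟩ (i ⊔ j)
  pairʷ nil        q          = along₂ q
  pairʷ (cons e p) nil        = along₁ (cons e p)
  pairʷ (cons e p) (cons f q) = cons (⟨⟩-adj (inj₂ (inj₂ (e , f)))) (pairʷ p q)

  project₁ : ∀ {a a' b b' k} → Walk P ⟨ a , b ⟩ ⟨ a' , b' ⟩ k → ∃ λ L → L ≤ k × Walk G a a' L
  project₁ {a} {a'} {b} {b'} w =
    len , len≤ , castʷ (π₁-⟨⟩ a b) (π₁-⟨⟩ a' b') walk
    where
      walkImage : WalkImage G π₁ w
      walkImage = mapʷ π₁-weak w
      open WalkImage walkImage

  project₂ : ∀ {a a' b b' k} → Walk P ⟨ a , b ⟩ ⟨ a' , b' ⟩ k → ∃ λ L → L ≤ k × Walk H b b' L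
  project₂ {a} {a'} {b} {b'} w =
    len , len≤ , castʷ (π₂-⟨⟩ a b) (π₂-⟨⟩ a' b') walk
    where
      walkImage : WalkImage H π₂ w
      walkImage = mapʷ π₂-weak w
      open WalkImage walkImage

  lift₁ : ∀ {x₁ x₂ g y₁ y₂ h i i' j j'} → OnGeodesic G x₁ x₂ g i i' →
          Walk H y₁ h j → Walk H h y₂ j' → j ≤ i → j' ≤ i' →
          InInterval P ⟨ x₁ , y₁ ⟩ ⟨ x₂ , y₂ ⟩ ⟨ g , h ⟩
  lift₁ {i = i} {i'} {j} {j'} (geodesic l r sh) q₁ q₂ j≤i j'≤i' =
    onGeodesic⇒interval (geodesic (pairʷ l q₁) (pairʷ r q₂) shortest)
    where
      shortest : ∀ k → Walk P _ _ k → (i ⊔ j) + (i' ⊔ j') ≤ k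
      shortest k w with project₁ w
      ... | L , L≤k , w₁ = begin
        (i ⊔ j) + (i' ⊔ j') ≡⟨ cong₂ _+_ (m≥n⇒m⊔n≡m j≤i) (m≥n⇒m⊔n≡m j'≤i') ⟩
        i + i'              ≤⟨ sh L w₁ ⟩
        L                   ≤⟨ L≤k ⟩
        k                   ∎
        where open ≤-Reasoning

  lift₂ : ∀ {x₁ x₂ g y₁ y₂ h i i' j j'} → Walk G x₁ g i → Walk G g x₂ i' →
          OnGeodesic H y₁ y₂ h j j' → i ≤ j → i' ≤ j' →
          InInterval P ⟨ x₁ , y₁ ⟩ ⟨ x₂ , y₂ ⟩ ⟨ g , h ⟩
  lift₂ {i = i} {i'} {j} {j'} p₁ p₂ (geodesic l r sh) i≤j i'≤j' =
    onGeodesic⇒interval (geodesic (pairʷ p₁ l) (pairʷ p₂ r) shortest)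
    where
      shortest : ∀ k → Walk P _ _ k → (i ⊔ j) + (i' ⊔ j') ≤ k
      shortest k w with project₂ w
      ... | L , L≤k , w₂ = begin
        (i ⊔ j) + (i' ⊔ j') ≡⟨ cong₂ _+_ (m≤n⇒m⊔n≡n i≤j) (m≤n⇒m⊔n≡n i'≤j') ⟩
        j + j'              ≤⟨ sh L w₂ ⟩
        L                   ≤⟨ L≤k ⟩
        k                   ∎
        where open ≤-Reasoning

  -- Every interval of G ⊠ H projects, classically, into an interval of G
  -- or into an interval of H: if both projections had shortcuts, their
  -- product would be a shortcut in G ⊠ H.
  shadow-interval : ∀ {p q x} → InInterval P p q x →
    ¬ ¬ (InInterval G (π₁ p) (π₁ q) (π₁ x) ⊎ InInterval H (π₂ p) (π₂ q) (π₂ x))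
  shadow-interval {p} {q} {x} (k , w , (_ , sh) , on) =
    ¬¬-map choose (¬¬-zip (lower-or-shorter (Walk G (π₁ p) (π₁ q)) k)
                          (lower-or-shorter (Walk H (π₂ p) (π₂ q)) k))
    where
      choose : LowerOrShorter (Walk G (π₁ p) (π₁ q)) k × LowerOrShorter (Walk H (π₂ p) (π₂ q)) k →
               InInterval G (π₁ p) (π₁ q) (π₁ x) ⊎ InInterval H (π₂ p) (π₂ q) (π₂ x)
      choose (inj₁ lower , _)       = inj₁ (image-interval π₁-weak w on lower)
      choose (inj₂ _ , inj₁ lower)  = inj₂ (image-interval π₂-weak w on lower)
      choose (inj₂ (L₁ , w₁ , L₁<k) , inj₂ (L₂ , w₂ , L₂<k)) =
        ⊥-elim (<⇒≱ (⊔-pres-<m L₁<k L₂<k) (sh _ (castʷ (⟨π₁,π₂⟩ p) (⟨π₁,π₂⟩ q) (pairʷ w₁ w₂))))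

module _ {G : Graph n} {H : Graph m} where
  open Strong G H

  pair-in-hull : ∀ {S T s₁ s₂ t₁ t₂ g h i i' j j'} → s₁ ∈ S → s₂ ∈ S → t₁ ∈ T → t₂ ∈ T →
                 OnGeodesic G s₁ s₂ g i i' → OnGeodesic H t₁ t₂ h j j' →
                 InHull P (S ×ˢ T) ⟨ g , h ⟩
  pair-in-hull {i = i} {i'} {j} {j'} s₁∈ s₂∈ t₁∈ t₂∈ γ δ with i ⊓ i' ≤? j ⊓ j'
  ... | yes μ≤ν with nearer-end s₁∈ s₂∈ γ
  ...   | s , s∈ , r = ⟨ s , _ ⟩ , ⟨ s , _ ⟩ , ∈-×ˢ s∈ t₁∈ , ∈-×ˢ s∈ t₂∈ ,
            lift₂ r (reverseʷ r) δ (≤-trans μ≤ν (m⊓n≤m j j')) (≤-trans μ≤ν (m⊓n≤n j j'))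
  pair-in-hull {i = i} {i'} s₁∈ s₂∈ t₁∈ t₂∈ γ δ | no μ≰ν with nearer-end t₁∈ t₂∈ δ
  ...   | t , t∈ , r = ⟨ _ , t ⟩ , ⟨ _ , t ⟩ , ∈-×ˢ s₁∈ t∈ , ∈-×ˢ s₂∈ t∈ ,
            lift₁ γ r (reverseʷ r) (≤-trans (≰⇒≥ μ≰ν) (m⊓n≤m i i')) (≤-trans (≰⇒≥ μ≰ν) (m⊓n≤n i i'))

  ×ˢ-geodetic : ∀ {S T} → Geodetic G S → Geodetic H T → Geodetic P (S ×ˢ T)
  ×ˢ-geodetic {S} {T} geoS geoT w =
    subst (InHull P (S ×ˢ T)) (⟨π₁,π₂⟩ w) (covered (geoS (π₁ w)) (geoT (π₂ w)))
    where
      covered : ∀ {g h} → InHull G S g → InHull H T h → InHull P (S ×ˢ T) ⟨ g , h ⟩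
      covered (_ , _ , s₁∈ , s₂∈ , Ig) (_ , _ , t₁∈ , t₂∈ , Ih)
        with interval⇒onGeodesic Ig | interval⇒onGeodesic Ih
      ... | _ , _ , γ | _ , _ , δ = pair-in-hull s₁∈ s₂∈ t₁∈ t₂∈ γ δ

  upper-bound : ∀ {a b c} → IsGeodeticNumber G a → IsGeodeticNumber H b →
                IsGeodeticNumber P c → c ≤ a * b
  upper-bound ((S , geoS , refl) , _) ((T , geoT , refl) , _) (_ , minimal) =
    ≤-trans (minimal (S ×ˢ T) (×ˢ-geodetic geoS geoT)) (∣×ˢ∣≤ S T)

module _ {G : Graph n} {H : Graph m} where
  open Strong G H

  shadow-geodetic : ∀ {S} → Geodetic P S →
                    ¬ ¬ (Geodetic G (image S π₁) ⊎ Geodetic H (image S π₂))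
  shadow-geodetic {S} geo = ¬¬-rectangle cell
    where
      cell : ∀ g h → ¬ ¬ (InHull G (image S π₁) g ⊎ InHull H (image S π₂) h)
      cell g h with geo ⟨ g , h ⟩
      ... | p , q , p∈ , q∈ , I = ¬¬-map shadow (shadow-interval I)
        where
          shadow : InInterval G (π₁ p) (π₁ q) (π₁ ⟨ g , h ⟩) ⊎ InInterval H (π₂ p) (π₂ q) (π₂ ⟨ g , h ⟩) →
                   InHull G (image S π₁) g ⊎ InHull H (image S π₂) h
          shadow (inj₁ Ig) = inj₁ (π₁ p , π₁ q , ∈-image p∈ , ∈-image q∈ ,
                                   subst (InInterval G _ _) (π₁-⟨⟩ g h) Ig)
          shadow (inj₂ Ih) = inj₂ (π₂ p , π₂ q , ∈-image p∈ , ∈-image q∈ ,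
                                   subst (InInterval H _ _) (π₂-⟨⟩ g h) Ih)

  lower-bound : ∀ {a b S} → IsGeodeticNumber G a → IsGeodeticNumber H b →
                Geodetic P S → a ⊓ b ≤ ∣ S ∣
  lower-bound {a} {b} {S} (_ , minimalG) (_ , minimalH) geo =
    decidable-stable (a ⊓ b ≤? ∣ S ∣) (¬¬-map bound (shadow-geodetic geo))
    where
      bound : Geodetic G (image S π₁) ⊎ Geodetic H (image S π₂) → a ⊓ b ≤ ∣ S ∣
      bound (inj₁ geoG) = ≤-trans (m⊓n≤m a b) (≤-trans (minimalG _ geoG) (∣image∣≤ S π₁))
      bound (inj₂ geoH) = ≤-trans (m⊓n≤n a b) (≤-trans (minimalH _ geoH) (∣image∣≤ S π₂))

strong-product-bounds : {G : Graph n} {H : Graph m} {a b c : ℕ} →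
                        IsGeodeticNumber G a → IsGeodeticNumber H b →
                        IsGeodeticNumber (G ⊠ H) c → a ⊓ b ≤ c × c ≤ a * b
strong-product-bounds gG gH gP@((_ , geo , refl) , _) = lower-bound gG gH geo , upper-bound gG gH gP

Complete : Graph n → Set
Complete {n} G = ∀ (u v : Fin n) → u ≡ v ⊎ Adj G u v

K : ∀ n → Graph n
K n = record
  { Adj     = λ u v → ¬ u ≡ v
  ; Adj-sym = λ u≢v v≡u → u≢v (sym v≡u)
  ; Adj-irr = λ u≢u → u≢u refl
  }

K-complete : ∀ n → Complete (K n)
K-complete n u v with u ≟ v
... | yes u≡v = inj₁ u≡v
... | no  u≢v = inj₂ u≢v

complete-walk : {G : Graph n} → Complete G → ∀ u v → ∃ λ j → j ≤ 1 × Walk G u v j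
complete-walk complete u v with complete u v
... | inj₁ refl = 0 , z≤n , nil
... | inj₂ a    = 1 , ≤-refl , cons a nil

complete-connected : {G : Graph n} → Complete G → Connected G
complete-connected complete u v with complete-walk complete u v
... | j , _ , p = j , p

module _ {G : Graph n} {H : Graph m} where
  open Strong G H

  ⊠-complete : Complete G → Complete H → Complete (G ⊠ H)
  ⊠-complete completeG completeH p q with completeG (π₁ p) (π₁ q) | completeH (π₂ p) (π₂ q)
  ... | inj₁ same₁ | inj₁ same₂ = inj₁ (begin
    p                 ≡⟨ sym (⟨π₁,π₂⟩ p) ⟩
    ⟨ π₁ p , π₂ p ⟩   ≡⟨ cong₂ ⟨_,_⟩ same₁ same₂ ⟩
    ⟨ π₁ q , π₂ q ⟩   ≡⟨ ⟨π₁,π₂⟩ q ⟩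
    q                 ∎)
    where open ≡-Reasoning
  ... | inj₁ same₁ | inj₂ b     = inj₂ (inj₁ (same₁ , b))
  ... | inj₂ a     | inj₁ same₂ = inj₂ (inj₂ (inj₁ (same₂ , a)))
  ... | inj₂ a     | inj₂ b     = inj₂ (inj₂ (inj₂ (a , b)))

short-walk-ends : {G : Graph n} {x y w : Fin n} (p : Walk G x y k) → k ≤ 1 →
                  OnWalk w p → w ≡ x ⊎ w ≡ y
short-walk-ends nil                 _        here-nil          = inj₁ refl
short-walk-ends (cons e p)          _        (here-cons .e .p) = inj₁ refl
short-walk-ends (cons e nil)        _        (there .e here-nil) = inj₂ refl
short-walk-ends (cons e (cons f p)) (s≤s ()) _

-- g(Kₙ) = n: every vertex must belong to a geodetic set, since intervals of
-- complete graphs consist of their ends only.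
complete-geodeticNumber : {G : Graph n} → Complete G → IsGeodeticNumber G n
complete-geodeticNumber {n} {G} complete =
  isGeodeticNumber ⊤ ⊤-geodetic (≤-reflexive (∣⊤∣≡n n)) minimal
  where
    ⊤-geodetic : Geodetic G ⊤
    ⊤-geodetic w = w , w , ∈⊤ , ∈⊤ , 0 , nil , (nil , λ _ _ → z≤n) , here-nil

    minimal : ∀ S → Geodetic G S → n ≤ ∣ S ∣
    minimal S geo = subst (_≤ ∣ S ∣) (∣⊤∣≡n n) (p⊆q⇒∣p∣≤∣q∣ ⊤⊆S)
      where
        ⊤⊆S : ⊤ ⊆ S
        ⊤⊆S {w} _ with geo w
        ... | x , y , x∈ , y∈ , _ , p , (_ , shortest) , on with complete-walk complete x y
        ...   | j , j≤1 , q with short-walk-ends p (≤-trans (shortest j q) j≤1) on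
        ...     | inj₁ refl = x∈
        ...     | inj₂ refl = y∈

InnerCover : Graph n → Subset n → Set
InnerCover {n} G T = ∀ g → Σ (Fin n) λ x → Σ (Fin n) λ y → x ∈ T × y ∈ T ×
                     ∃₂ λ i j → OnGeodesic G x y g (suc i) (suc j)

innerCover-geodetic : {G : Graph n} {T : Subset n} → InnerCover G T → Geodetic G T
innerCover-geodetic cover g with cover g
... | x , y , x∈ , y∈ , _ , _ , γ = x , y , x∈ , y∈ , onGeodesic⇒interval γ

-- For complete H, a single copy T × {h₀} of an inner cover is geodetic in
-- G ⊠ H: the H-legs, of length at most 1, never exceed the inner G-legs.
innerCover-⊠-geodetic : {G : Graph n} {H : Graph m} {T : Subset n} → InnerCover G T →
                        Complete H → (h₀ : Fin m) → Geodetic (G ⊠ H) (T ×ˢ ⁅ h₀ ⁆)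
innerCover-⊠-geodetic {G = G} {H} {T} cover complete h₀ w =
  subst (InHull P (T ×ˢ ⁅ h₀ ⁆)) (⟨π₁,π₂⟩ w) covered
  where
    open Strong G H
    covered : InHull P (T ×ˢ ⁅ h₀ ⁆) ⟨ π₁ w , π₂ w ⟩
    covered with cover (π₁ w) | complete-walk complete h₀ (π₂ w) | complete-walk complete (π₂ w) h₀
    ... | x , y , x∈ , y∈ , _ , _ , γ | _ , j≤1 , q₁ | _ , j'≤1 , q₂ =
      ⟨ x , h₀ ⟩ , ⟨ y , h₀ ⟩ , ∈-×ˢ x∈ (x∈⁅x⁆ h₀) , ∈-×ˢ y∈ (x∈⁅x⁆ h₀) ,
      lift₁ γ q₁ q₂ (≤-trans j≤1 (s≤s z≤n)) (≤-trans j'≤1 (s≤s z≤n))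

module DiameterTwo {n : ℕ} (G : Graph n) (adj? : ∀ u v → Dec (Adj G u v))
                   (close : ∀ u v → u ≡ v ⊎ Adj G u v ⊎ ∃ λ w → Adj G u w × Adj G w v) where

  dist : Fin n → Fin n → ℕ
  dist u v with u ≟ v | adj? u v
  ... | yes _ | _     = 0
  ... | no _  | yes _ = 1
  ... | no _  | no _  = 2

  dist≤2 : ∀ u v → dist u v ≤ 2
  dist≤2 u v with u ≟ v | adj? u v
  ... | yes _ | _     = z≤n
  ... | no _  | yes _ = s≤s z≤n
  ... | no _  | no _  = ≤-refl

  dist-lower : ∀ {u v k} → Walk G u v k → dist u v ≤ k
  dist-lower {u} nil with u ≟ u | adj? u u
  ... | yes _   | _ = z≤n
  ... | no u≢u  | _ = ⊥-elim (u≢u refl)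
  dist-lower {u} {v} (cons e nil) with u ≟ v | adj? u v
  ... | yes _ | _     = z≤n
  ... | no _  | yes _ = ≤-refl
  ... | no _  | no ¬e = ⊥-elim (¬e e)
  dist-lower {u} {v} (cons _ (cons _ _)) = ≤-trans (dist≤2 u v) (s≤s (s≤s z≤n))

  dist-walk : ∀ u v → Walk G u v (dist u v)
  dist-walk u v with u ≟ v | adj? u v | close u v
  ... | yes refl | _     | _                            = nil
  ... | no _     | yes e | _                            = cons e nil
  ... | no u≢v   | no _  | inj₁ u≡v                     = ⊥-elim (u≢v u≡v)
  ... | no _     | no ¬e | inj₂ (inj₁ e)                = ⊥-elim (¬e e)
  ... | no _     | no _  | inj₂ (inj₂ (_ , e₁ , e₂))    = cons e₁ (cons e₂ nil)

  connected : Connected G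
  connected u v = dist u v , dist-walk u v

  midpoint-onGeodesic : ∀ {x y g} → Adj G x g → Adj G g y → dist x y ≡ 2 → OnGeodesic G x y g 1 1
  midpoint-onGeodesic e₁ e₂ d≡2 =
    geodesic (cons e₁ nil) (cons e₂ nil) λ k p → subst (_≤ k) d≡2 (dist-lower p)

  interval⇒dist : ∀ {x y w} → InInterval G x y w → dist x w + dist w y ≤ dist x y
  interval⇒dist I with interval⇒onGeodesic I
  ... | _ , _ , geodesic l r shortest =
    ≤-trans (+-mono-≤ (dist-lower l) (dist-lower r)) (shortest _ (dist-walk _ _))

-- Vertices 0, …, 7; edges 01 02 04 05 14 16 17 26 27 34 35 37 46 47 56 57.
adjacency₈ : Vec (Vec Bool 8) 8
adjacency₈ =
  (false ∷ true  ∷ true  ∷ false ∷ true  ∷ true  ∷ false ∷ false ∷ []) ∷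
  (true  ∷ false ∷ false ∷ false ∷ true  ∷ false ∷ true  ∷ true  ∷ []) ∷
  (true  ∷ false ∷ false ∷ false ∷ false ∷ false ∷ true  ∷ true  ∷ []) ∷
  (false ∷ false ∷ false ∷ false ∷ true  ∷ true  ∷ false ∷ true  ∷ []) ∷
  (true  ∷ true  ∷ false ∷ true  ∷ false ∷ false ∷ true  ∷ true  ∷ []) ∷
  (true  ∷ false ∷ false ∷ true  ∷ false ∷ false ∷ true  ∷ true  ∷ []) ∷
  (false ∷ true  ∷ true  ∷ false ∷ true  ∷ true  ∷ false ∷ false ∷ []) ∷
  (false ∷ true  ∷ true  ∷ true  ∷ true  ∷ true  ∷ false ∷ false ∷ []) ∷ []

adj₈ : Fin 8 → Fin 8 → Bool
adj₈ u v = lookup (lookup adjacency₈ u) v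

-- The finite checks below are certificates computed by evaluation; they are kept
-- abstract so that they are evaluated once rather than at every use.
abstract
  adj₈-symmetric : ∀ u v → T (adj₈ u v) → T (adj₈ v u)
  adj₈-symmetric = toWitness {a? = all? λ u → all? λ v → T? (adj₈ u v) →-dec T? (adj₈ v u)} _

  adj₈-irreflexive : ∀ u → ¬ T (adj₈ u u)
  adj₈-irreflexive = toWitness {a? = all? λ u → ¬? (T? (adj₈ u u))} _

G₈ : Graph 8
G₈ = record
  { Adj     = λ u v → T (adj₈ u v)
  ; Adj-sym = λ {u} {v} → adj₈-symmetric u v
  ; Adj-irr = λ {u} → adj₈-irreflexive u
  }

abstract
  G₈-close : ∀ u v → u ≡ v ⊎ Adj G₈ u v ⊎ ∃ λ w → Adj G₈ u w × Adj G₈ w v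
  G₈-close = toWitness {a? = all? λ u → all? λ v →
    (u ≟ v) ⊎-dec (T? (adj₈ u v) ⊎-dec any? λ w → T? (adj₈ u w) ×-dec T? (adj₈ w v))} _

open DiameterTwo G₈ (λ u v → T? (adj₈ u v)) G₈-close
  using ()
  renaming (dist to dist₈; midpoint-onGeodesic to midpoint-onGeodesic₈; connected to G₈-connected;
            interval⇒dist to interval⇒dist₈)

-- T₈ = {0, 4, 5, 6}.
T₈ : Subset 8
T₈ = inside ∷ outside ∷ outside ∷ outside ∷ inside ∷ inside ∷ inside ∷ outside ∷ []

abstract
  T₈-midpoints : ∀ g → ∃ λ x → ∃ λ y → x ∈ T₈ × y ∈ T₈ ×
                 Adj G₈ x g × Adj G₈ g y × dist₈ x y ≡ 2
  T₈-midpoints = toWitness {a? = all? λ g → any? λ x → any? λ y →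
    (x ∈? T₈) ×-dec (y ∈? T₈) ×-dec T? (adj₈ x g) ×-dec T? (adj₈ g y) ×-dec (dist₈ x y ≟ℕ 2)} _

T₈-innerCover : InnerCover G₈ T₈
T₈-innerCover g =
  let (x , y , x∈ , y∈ , e₁ , e₂ , d≡2) = T₈-midpoints g
  in  x , y , x∈ , y∈ , 0 , 0 , midpoint-onGeodesic₈ e₁ e₂ d≡2

DistHull : Subset 8 → Set
DistHull S = ∀ w → ∃ λ x → ∃ λ y → x ∈ S × y ∈ S × dist₈ x w + dist₈ w y ≤ dist₈ x y

-- Exhaustive search over all 256 subsets: no set of fewer than four vertices works.
abstract
  no-small-distHull : ¬ ∃ λ S → DistHull S × ∣ S ∣ < 4
  no-small-distHull = toWitnessFalse {a? = anySubset? λ S →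
    (all? λ w → any? λ x → any? λ y → (x ∈? S) ×-dec (y ∈? S) ×-dec
       (dist₈ x w + dist₈ w y ≤? dist₈ x y))
    ×-dec (∣ S ∣ <? 4)} _

G₈-geodeticNumber : IsGeodeticNumber G₈ 4
G₈-geodeticNumber = isGeodeticNumber T₈ (innerCover-geodetic T₈-innerCover) ≤-refl minimal
  where
    minimal : ∀ S → Geodetic G₈ S → 4 ≤ ∣ S ∣
    minimal S geo = ≮⇒≥ λ small → no-small-distHull (S , distHull , small)
      where
        distHull : DistHull S
        distHull w with geo w
        ... | x , y , x∈ , y∈ , I = x , y , x∈ , y∈ , interval⇒dist₈ I

G₈⊠K₄-geodeticNumber : IsGeodeticNumber (G₈ ⊠ K 4) 4
G₈⊠K₄-geodeticNumber =
  isGeodeticNumber (T₈ ×ˢ ⁅ zero {n = 3} ⁆) (innerCover-⊠-geodetic T₈-innerCover (K-complete 4) zero)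
    (∣×ˢ∣≤ T₈ ⁅ zero {n = 3} ⁆)
    (λ S geo → lower-bound G₈-geodeticNumber (complete-geodeticNumber (K-complete 4)) geo)

theorem1 :
    (∀ (n m : ℕ) (G : Graph n) (H : Graph m) →
      2 ≤ n → 2 ≤ m → Connected G → Connected H →
      ∀ (a b c : ℕ) → IsGeodeticNumber G a → IsGeodeticNumber H b →
      IsGeodeticNumber (G ⊠ H) c →
      (a ⊓ b ≤ c) × (c ≤ a * b))
    ×
    (Σ ℕ λ n → Σ ℕ λ m → Σ (Graph n) λ G → Σ (Graph m) λ H →
      2 ≤ n × 2 ≤ m × Connected G × Connected H ×
      Σ ℕ λ a → Σ ℕ λ b → Σ ℕ λ c →
      IsGeodeticNumber G a × IsGeodeticNumber H b ×
      IsGeodeticNumber (G ⊠ H) c × c ≡ a ⊓ b)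
    ×
    (Σ ℕ λ n → Σ ℕ λ m → Σ (Graph n) λ G → Σ (Graph m) λ H →
      2 ≤ n × 2 ≤ m × Connected G × Connected H ×
      Σ ℕ λ a → Σ ℕ λ b → Σ ℕ λ c →
      IsGeodeticNumber G a × IsGeodeticNumber H b ×
      IsGeodeticNumber (G ⊠ H) c × c ≡ a * b)
theorem1 =
    (λ _ _ _ _ _ _ _ _ _ _ _ → strong-product-bounds)
  ,
    ( 8 , 4 , G₈ , K 4 , 2≤ , 2≤ , G₈-connected , complete-connected (K-complete 4)
    , 4 , 4 , 4 , G₈-geodeticNumber , complete-geodeticNumber (K-complete 4)
    , G₈⊠K₄-geodeticNumber , refl )
  , -- upper bound attained: K₂ ⊠ K₂ = K₄, so g = 4 = 2 · 2
    ( 2 , 2 , K 2 , K 2 , 2≤ , 2≤ , complete-connected (K-complete 2) , complete-connected (K-complete 2)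
    , 2 , 2 , 4 , complete-geodeticNumber (K-complete 2) , complete-geodeticNumber (K-complete 2)
    , complete-geodeticNumber (⊠-complete {G = K 2} {H = K 2} (K-complete 2) (K-complete 2)) , refl )
  where
    2≤ : ∀ {k} → 2 ≤ 2 + k
    2≤ = s≤s (s≤s z≤n)
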